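{- Let $N$ be a complete (not necessarily binary) $\mathcal{L}$-network and $T$ a root component of $N$ such that $\mathrm{adm}(T)\neq\emptyset$. Then the vector $\mu(e,v)+\mu(e,u)$ does not depend on the choice of the edge $e\in\mathrm{adm}(T)$, where $u,v$ are the endpoints of $e$.
   Context: A semidirected graph has a finite node set and a finite multiset of edges, each either undirected or directed from parent to child. A node is a root if it has no incoming directed edge and no undirected edge, a leaf if it has no outgoing directed edge and no undirected edge, a hybrid node if it has at least two incoming directed edges. Semidirected paths (cycles) are those whose undirected edges can be oriented to make them directed; an SDAG has no semidirected cycle. For $\mathcal{L}=[n]$, an $\mathcal{L}$-network is an SDAG whose leaves have at most one incoming edge, with an injective labelling of leaves by $\mathcal{L}$. $u\sim v$ if joined by a path of undirected edges; $N/{\sim}$ contracts all undirected edges. $N$ is complete if edges at leaves are directed towards leaves and no $\sim$-class with more than one node has an incoming directed edge in $N/{\sim}$. A root component is the subgraph induced by a $\sim$-class that is a root of $N/{\sim}$. $\mathrm{adm}(T)$ is the set of edges of $T$ together with all edges of $N$ incident to a node of $T$. For nodes $v,x$ and an edge $e$, $m(v,x;e)$ is the number of semidirected paths from $v$ to $x$ not containing $e$. For an edge $e$ with endpoints $u,v$: $\mu(e,v)=(\mu_0(e,v),\dots,\mu_n(e,v))$ with $\mu_i(e,v)=m(v,i;e)$ for $i\in[n]$ (0 if $i$ is not a leaf) and $\mu_0(e,v)=\sum_{h\text{ hybrid}}m(v,h;e)$; $\mu(e,u)$ is defined symmetrically. -}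

module Defs where

open import Data.Nat using (ℕ; suc; _≤_; _+_; _≤ᵇ_)
open import Data.Fin using (Fin; _≟_)
open import Data.Bool using (Bool; true; false; T; not; _∧_; _∨_)
open import Data.List using (List; []; _∷_; _++_; length; allFin; filterᵇ)
open import Data.Bool.ListAction using (any)
open import Data.Product using (Σ; ∃; _×_; _,_)
open import Data.Sum using (_⊎_)
open import Relation.Nullary using (¬_)
open import Relation.Nullary.Decidable using (⌊_⌋; True; False)
open import Relation.Binary.PropositionalEquality using (_≡_)
open import Relation.Binary.Construct.Closure.ReflexiveTransitive using (Star)
open import Function.Bundles using (_↔_)
import Data.List.Relation.Unary.Unique.DecPropositional as UniqueDec
import Data.List.Membership.DecPropositional as MemDec

HasCard : Set → ℕ → Set
HasCard A c = Fin c ↔ A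

data Kind : Set where
  undir dir : Kind

isUndirK : Kind → Bool
isUndirK undir = true
isUndirK dir   = false

-- An edge: for a directed edge, src is the parent and tgt the child.
-- For an undirected edge the orientation src/tgt is an arbitrary choice.
record Edge (k : ℕ) : Set where
  constructor mkEdge
  field
    kind : Kind
    src  : Fin k
    tgt  : Fin k

record SDGraph : Set where
  constructor mkGraph
  field
    k    : ℕ
    m    : ℕ
    edge : Fin m → Edge k

module GraphDefs (G : SDGraph) where
  open SDGraph G public

  Node : Set
  Node = Fin k

  EdgeId : Set
  EdgeId = Fin m

  src tgt : EdgeId → Node
  src f = Edge.src (edge f)
  tgt f = Edge.tgt (edge f)

  isUndir isDir : EdgeId → Bool
  isUndir f = isUndirK (Edge.kind (edge f))
  isDir f = not (isUndir f)

  _==_ : Node → Node → Bool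
  x == y = ⌊ x ≟ y ⌋

  indeg : Node → ℕ
  indeg x = length (filterᵇ (λ f → isDir f ∧ (tgt f == x)) (allFin m))

  undirAt : Node → EdgeId → Bool
  undirAt x f = isUndir f ∧ ((src f == x) ∨ (tgt f == x))

  isRoot : Node → Bool
  isRoot x = not (any (λ f → (isDir f ∧ (tgt f == x)) ∨ undirAt x f) (allFin m))

  isLeaf : Node → Bool
  isLeaf x = not (any (λ f → (isDir f ∧ (src f == x)) ∨ undirAt x f) (allFin m))

  isHybrid : Node → Bool
  isHybrid x = 2 ≤ᵇ indeg x

  data SWalk : Node → Node → Set where
    []  : ∀ {a} → SWalk a a
    fwd : ∀ {b} (f : EdgeId) → SWalk (tgt f) b → SWalk (src f) b
    bwd : ∀ {b} (f : EdgeId) → T (isUndir f) → SWalk (src f) b → SWalk (tgt f) b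

  verts : ∀ {a b} → SWalk a b → List Node
  verts {a} []    = a ∷ []
  verts (fwd f w) = src f ∷ verts w
  verts (bwd f _ w) = tgt f ∷ verts w

  edgesOf : ∀ {a b} → SWalk a b → List EdgeId
  edgesOf []    = []
  edgesOf (fwd f w) = f ∷ edgesOf w
  edgesOf (bwd f _ w) = f ∷ edgesOf w

  tailL : List Node → List Node
  tailL []       = []
  tailL (_ ∷ xs) = xs

  record SDPath (v x : Node) (e : EdgeId) : Set where
    constructor mkPath
    field
      walk     : SWalk v x
      distinct : True (UniqueDec.unique? _≟_ (verts walk))
      avoids   : False (MemDec._∈?_ _≟_ e (edgesOf walk))

  SDCycle : Set
  SDCycle = Σ Node λ a → Σ (SWalk a a) λ w →
              (1 ≤ length (edgesOf w)) ×
              True (UniqueDec.unique? _≟_ (edgesOf w)) ×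
              True (UniqueDec.unique? _≟_ (tailL (verts w)))

  SDAG : Set
  SDAG = ¬ SDCycle

  UAdj : Node → Node → Set
  UAdj u w = Σ EdgeId λ f → T (isUndir f) ×
               ((src f ≡ u × tgt f ≡ w) ⊎ (src f ≡ w × tgt f ≡ u))

  _∼_ : Node → Node → Set
  _∼_ = Star UAdj

-- L-networks with L = [n] = Fin n.  The labelling lab is only relevant on
-- leaves (its values at non-leaves are ignored); it is injective on leaves.

record Network (n : ℕ) : Set where
  field
    graph : SDGraph
  open GraphDefs graph
  field
    sdag      : SDAG
    leafIn    : ∀ x → T (isLeaf x) → indeg x ≤ 1
    lab       : Node → Fin n
    labInj    : ∀ x y → T (isLeaf x) → T (isLeaf y) → lab x ≡ lab y → x ≡ y

module NetDefs {n : ℕ} (N : Network n) where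
  open Network N public using (graph; lab)
  open GraphDefs graph public

  -- Completeness: (1) every edge at a leaf is directed towards the leaf;
  -- (2) no ∼-class with more than one node has an incoming directed edge
  -- in N/∼.
  Complete : Set
  Complete =
    (∀ (x : Node) (f : EdgeId) → T (isLeaf x) → (src f ≡ x ⊎ tgt f ≡ x) →
       T (isDir f) × tgt f ≡ x)
    ×
    (∀ (v : Node) → (Σ Node λ w → (v ∼ w) × ¬ (w ≡ v)) →
       ∀ (f : EdgeId) → T (isDir f) → ¬ (tgt f ∼ v))

  -- The ∼-class of r is a root of N/∼ (no incoming directed edge; N/∼ has
  -- no undirected edges); its induced subgraph is a root component.
  RootClass : Node → Set
  RootClass r = ∀ (f : EdgeId) → T (isDir f) → ¬ (r ∼ tgt f)

  -- adm(T) for T the class of r: edges of T together with all edges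
  -- incident to a node of T.
  Adm : Node → EdgeId → Set
  Adm r f = (r ∼ src f) ⊎ (r ∼ tgt f)

  -- The set whose cardinality is μ_j(e,v):
  --  j = 0      : Σ_{h hybrid} m(v,h;e)
  --  j = i + 1  : m(v,x;e) for the leaf x labelled i (empty if none)
  MuSet : EdgeId → Node → Fin (suc n) → Set
  MuSet e v Fin.zero    = Σ Node λ h → T (isHybrid h) × SDPath v h e
  MuSet e v (Fin.suc i) = Σ Node λ x → T (isLeaf x) × (lab x ≡ i) × SDPath v x e

{-# OPTIONS --safe #-}
module Submission where

-- Let w be a node of the root component T and e an edge at w. No directed edge enters T, so e
-- can be traversed away from w. A semidirected path avoiding e that starts at w is trivial or
-- leaves w by a step s ≠ e; one that starts at the far endpoint of e is what remains of a path
-- leaving w by e once that first step is removed. By acyclicity the rest of such a path never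
-- returns to w, so it avoids both e and s automatically. Hence the paths to x from the two
-- endpoints of e correspond to (w = x) ⊎ Σ_s (paths from the end of s avoiding s), which does
-- not mention e. An undirected edge of T lies at both of its endpoints, so this count is the
-- same for every edge at every node of T, that is, for every edge of adm(T).

open import Defs
open import Data.Nat using (ℕ; suc; _+_; z≤n; s≤s; _≤_)
open import Data.Fin using (Fin; _≟_)
open import Data.Fin.Properties using (+↔⊎)
open import Data.Fin.Permutation using (↔⇒≡)
open import Data.Bool using (true; false; T; not)
open import Data.Bool.Properties using (T-irrelevant)
open import Data.Empty using (⊥; ⊥-elim)
open import Data.Unit using (tt)
open import Data.List using ([]; _∷_; length)
open import Data.List.Membership.Propositional using (_∈_; _∉_)
open import Data.List.Relation.Unary.Any using (here; there)
open import Data.List.Relation.Unary.All using ([])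
open import Data.List.Relation.Unary.All.Properties using (¬Any⇒All¬; All¬⇒¬Any)
open import Data.List.Relation.Unary.AllPairs as AllPairs using ([]; _∷_)
open import Data.List.Relation.Unary.Unique.Propositional using (Unique)
open import Data.List.Relation.Unary.Unique.Propositional.Properties using (Unique[x∷xs]⇒x∉xs)
open import Data.Product using (Σ; _×_; _,_; proj₁; proj₂; map)
open import Data.Product.Function.Dependent.Propositional using (Σ-↔)
open import Data.Sum using (_⊎_; inj₁; inj₂)
open import Data.Sum.Function.Propositional using (_⊎-↔_)
open import Function.Base using (_∘_)
open import Function.Bundles using (_↔_; mk↔ₛ′)
open import Function.Properties.Inverse using (↔-refl; ↔-sym; ↔-trans)
open import Function.Related.Propositional using (module EquationalReasoning)
open import Function.Related.TypeIsomorphisms using (Σ-distribˡ-⊎; ⊎-assoc; ⊎-comm)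
open import Relation.Binary.Definitions using (DecidableEquality)
open import Relation.Binary.PropositionalEquality using (_≡_; _≢_; refl; sym; trans; cong; cong₂; subst)
open import Relation.Binary.Construct.Closure.ReflexiveTransitive using (ε; _◅_; _◅◅_; reverse)
open import Relation.Nullary using (¬_; Dec; yes; no)
open import Relation.Nullary.Decidable using (False; toWitness; fromWitness; toWitnessFalse; fromWitnessFalse)
import Data.List.Relation.Unary.Unique.DecPropositional as UniqueDec
import Data.List.Membership.DecPropositional as MemDec

¬T-not⇒T : ∀ {b} → ¬ T (not b) → T b
¬T-not⇒T {true}  _ = tt
¬T-not⇒T {false} ¬t = ⊥-elim (¬t tt)

Σ-⊎-cong : {I : Set} {A B C D : I → Set} → (∀ i → (A i ⊎ B i) ↔ (C i ⊎ D i)) →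
           (Σ I A ⊎ Σ I B) ↔ (Σ I C ⊎ Σ I D)
Σ-⊎-cong A⊎B↔C⊎D =
  ↔-trans (↔-sym Σ-distribˡ-⊎) (↔-trans (Σ-↔ ↔-refl (A⊎B↔C⊎D _)) Σ-distribˡ-⊎)

module _ {A K : Set} (_≟ᴷ_ : DecidableEquality K) (key : A → K) (P : A → Set)
         (a₀ : A) (key-injective : ∀ a → key a₀ ≡ key a → a₀ ≡ a) where

  Σ-split : Σ A P ↔ (P a₀ ⊎ Σ A λ a → False (key a₀ ≟ᴷ key a) × P a)
  Σ-split = mk↔ₛ′ to from to∘from from∘to
    where
    Rest : Set
    Rest = Σ A λ a → False (key a₀ ≟ᴷ key a) × P a

    to-by : ∀ a → P a → Dec (key a₀ ≡ key a) → P a₀ ⊎ Rest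
    to-by a p (yes eq) = inj₁ (subst P (sym (key-injective a eq)) p)
    to-by a p (no ne)  = inj₂ (a , fromWitnessFalse ne , p)

    to : Σ A P → P a₀ ⊎ Rest
    to (a , p) = to-by a p (key a₀ ≟ᴷ key a)

    from : P a₀ ⊎ Rest → Σ A P
    from (inj₁ p)           = a₀ , p
    from (inj₂ (a , _ , p)) = a , p

    to∘from : ∀ z → to (from z) ≡ z
    to∘from (inj₁ p) with key a₀ ≟ᴷ key a₀
    ... | no ne  = ⊥-elim (ne refl)
    ... | yes eq with key-injective a₀ eq
    ...   | refl = refl
    to∘from (inj₂ (a , ne , p)) = to-by-no (key a₀ ≟ᴷ key a)
      where
      to-by-no : (d : Dec (key a₀ ≡ key a)) → to-by a p d ≡ inj₂ (a , ne , p)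
      to-by-no (yes eq) = ⊥-elim (toWitnessFalse ne eq)
      to-by-no (no _)   = cong (λ ne′ → inj₂ (a , ne′ , p)) (T-irrelevant _ _)

    from∘to : ∀ z → from (to z) ≡ z
    from∘to (a , p) with key a₀ ≟ᴷ key a
    ... | no _   = refl
    ... | yes eq with key-injective a eq
    ...   | refl = refl

module Walks (G : SDGraph) where
  open GraphDefs G

  Step : Node → Set
  Step y = Σ EdgeId λ g → src g ≡ y ⊎ (T (isUndir g) × tgt g ≡ y)

  stepEnd : ∀ {y} → Step y → Node
  stepEnd (g , inj₁ _) = tgt g
  stepEnd (g , inj₂ _) = src g

  _◃_ : ∀ {y b} (s : Step y) → SWalk (stepEnd s) b → SWalk y b
  (g , inj₁ refl)       ◃ w = fwd g w
  (g , inj₂ (u , refl)) ◃ w = bwd g u w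

  verts-◃ : ∀ {y b} (s : Step y) (w : SWalk (stepEnd s) b) → verts (s ◃ w) ≡ y ∷ verts w
  verts-◃ (g , inj₁ refl)       w = refl
  verts-◃ (g , inj₂ (u , refl)) w = refl

  edgesOf-◃ : ∀ {y b} (s : Step y) (w : SWalk (stepEnd s) b) →
              edgesOf (s ◃ w) ≡ proj₁ s ∷ edgesOf w
  edgesOf-◃ (g , inj₁ refl)       w = refl
  edgesOf-◃ (g , inj₂ (u , refl)) w = refl

  Incident : EdgeId → Node → Set
  Incident f y = src f ≡ y ⊎ tgt f ≡ y

  UAdj-incidentˡ : ∀ {a c} (g : UAdj a c) → Incident (proj₁ g) a
  UAdj-incidentˡ (_ , _ , inj₁ (g-from-a , _)) = inj₁ g-from-a
  UAdj-incidentˡ (_ , _ , inj₂ (_ , g-into-a)) = inj₂ g-into-a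

  UAdj-incidentʳ : ∀ {a c} (g : UAdj a c) → Incident (proj₁ g) c
  UAdj-incidentʳ (_ , _ , inj₁ (_ , g-into-c)) = inj₂ g-into-c
  UAdj-incidentʳ (_ , _ , inj₂ (g-from-c , _)) = inj₁ g-from-c

  UAdj-sym : ∀ {a c} → UAdj a c → UAdj c a
  UAdj-sym (g , g-undir , inj₁ ends) = g , g-undir , inj₂ ends
  UAdj-sym (g , g-undir , inj₂ ends) = g , g-undir , inj₁ ends

  step-incident : ∀ {y} (s : Step y) → Incident (proj₁ s) y
  step-incident (g , inj₁ g-from-y)       = inj₁ g-from-y
  step-incident (g , inj₂ (_ , g-into-y)) = inj₂ g-into-y

  start∈verts : ∀ {a b} (w : SWalk a b) → a ∈ verts w
  start∈verts []          = here refl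
  start∈verts (fwd _ _)   = here refl
  start∈verts (bwd _ _ _) = here refl

  ends∈verts : ∀ {a b f} (w : SWalk a b) → f ∈ edgesOf w → src f ∈ verts w × tgt f ∈ verts w
  ends∈verts (fwd g w)   (here refl) = here refl , there (start∈verts w)
  ends∈verts (bwd g _ w) (here refl) = there (start∈verts w) , here refl
  ends∈verts (fwd g w)   (there f∈w) = map there there (ends∈verts w f∈w)
  ends∈verts (bwd g _ w) (there f∈w) = map there there (ends∈verts w f∈w)

  incident∉edgesOf : ∀ {a b f y} (w : SWalk a b) → Incident f y → y ∉ verts w → f ∉ edgesOf w
  incident∉edgesOf w (inj₁ refl) y∉w f∈w = y∉w (proj₁ (ends∈verts w f∈w))
  incident∉edgesOf w (inj₂ refl) y∉w f∈w = y∉w (proj₂ (ends∈verts w f∈w))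

  edgesOf-unique : ∀ {a b} (w : SWalk a b) → Unique (verts w) → Unique (edgesOf w)
  edgesOf-unique []          _         = []
  edgesOf-unique (fwd g w)   (a∉w ∷ u) =
    ¬Any⇒All¬ _ (incident∉edgesOf w (inj₁ refl) (All¬⇒¬Any a∉w)) ∷ edgesOf-unique w u
  edgesOf-unique (bwd g _ w) (a∉w ∷ u) =
    ¬Any⇒All¬ _ (incident∉edgesOf w (inj₂ refl) (All¬⇒¬Any a∉w)) ∷ edgesOf-unique w u

  prefix : ∀ {a b y} (w : SWalk a b) → y ∈ verts w → SWalk a y
  prefix []          (here refl) = []
  prefix (fwd _ _)   (here refl) = []
  prefix (bwd _ _ _) (here refl) = []
  prefix (fwd g w)   (there y∈w) = fwd g (prefix w y∈w)
  prefix (bwd g u w) (there y∈w) = bwd g u (prefix w y∈w)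

  prefix-verts⊆ : ∀ {a b y z} (w : SWalk a b) (y∈w : y ∈ verts w) →
                  z ∈ verts (prefix w y∈w) → z ∈ verts w
  prefix-verts⊆ []          (here refl) z∈         = z∈
  prefix-verts⊆ (fwd _ _)   (here refl) (here refl) = here refl
  prefix-verts⊆ (bwd _ _ _) (here refl) (here refl) = here refl
  prefix-verts⊆ (fwd _ w)   (there y∈w) (here refl) = here refl
  prefix-verts⊆ (bwd _ _ w) (there y∈w) (here refl) = here refl
  prefix-verts⊆ (fwd _ w)   (there y∈w) (there z∈) = there (prefix-verts⊆ w y∈w z∈)
  prefix-verts⊆ (bwd _ _ w) (there y∈w) (there z∈) = there (prefix-verts⊆ w y∈w z∈)

  prefix-edgesOf⊆ : ∀ {a b y f} (w : SWalk a b) (y∈w : y ∈ verts w) →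
                    f ∈ edgesOf (prefix w y∈w) → f ∈ edgesOf w
  prefix-edgesOf⊆ []          (here refl) ()
  prefix-edgesOf⊆ (fwd _ _)   (here refl) ()
  prefix-edgesOf⊆ (bwd _ _ _) (here refl) ()
  prefix-edgesOf⊆ (fwd _ w)   (there y∈w) (here refl) = here refl
  prefix-edgesOf⊆ (bwd _ _ w) (there y∈w) (here refl) = here refl
  prefix-edgesOf⊆ (fwd _ w)   (there y∈w) (there f∈) = there (prefix-edgesOf⊆ w y∈w f∈)
  prefix-edgesOf⊆ (bwd _ _ w) (there y∈w) (there f∈) = there (prefix-edgesOf⊆ w y∈w f∈)

  prefix-unique : ∀ {a b y} (w : SWalk a b) (y∈w : y ∈ verts w) →
                  Unique (verts w) → Unique (verts (prefix w y∈w))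
  prefix-unique []          (here refl) u         = u
  prefix-unique (fwd _ _)   (here refl) _         = [] ∷ []
  prefix-unique (bwd _ _ _) (here refl) _         = [] ∷ []
  prefix-unique (fwd _ w)   (there y∈w) (a∉w ∷ u) =
    ¬Any⇒All¬ _ (λ a∈ → All¬⇒¬Any a∉w (prefix-verts⊆ w y∈w a∈)) ∷ prefix-unique w y∈w u
  prefix-unique (bwd _ _ w) (there y∈w) (a∉w ∷ u) =
    ¬Any⇒All¬ _ (λ a∈ → All¬⇒¬Any a∉w (prefix-verts⊆ w y∈w a∈)) ∷ prefix-unique w y∈w u

  PathsAfter : ∀ {y} → Node → Step y → Set
  PathsAfter x s = SDPath (stepEnd s) x (proj₁ s)

  path : ∀ {v x e} (w : SWalk v x) → Unique (verts w) → e ∉ edgesOf w → SDPath v x e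
  path w u e∉w = mkPath w (fromWitness u) (fromWitnessFalse e∉w)

  module _ {v x e} (p : SDPath v x e) where
    open SDPath p

    path-unique : Unique (verts walk)
    path-unique = toWitness {a? = UniqueDec.unique? _≟_ (verts walk)} distinct

    path-avoids : e ∉ edgesOf walk
    path-avoids = toWitnessFalse {a? = MemDec._∈?_ _≟_ e (edgesOf walk)} avoids

  SDPath-≡ : ∀ {v x e} {p q : SDPath v x e} → SDPath.walk p ≡ SDPath.walk q → p ≡ q
  SDPath-≡ {p = mkPath w _ _} refl = cong₂ (mkPath w) (T-irrelevant _ _) (T-irrelevant _ _)

  module Acyclic (acyclic : SDAG) where

    no-closed-walk : ∀ {a b} (w : SWalk a b) → a ≡ b → 1 ≤ length (edgesOf w) →
                     Unique (edgesOf w) → Unique (tailL (verts w)) → ⊥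
    no-closed-walk w refl nonempty u-edges u-verts =
      acyclic (_ , w , nonempty , fromWitness u-edges , fromWitness u-verts)

    src≢tgt : ∀ f → src f ≢ tgt f
    src≢tgt f loop = no-closed-walk (fwd f []) loop (s≤s z≤n) ([] ∷ []) ([] ∷ [])

    ◃-no-cycle : ∀ {y} (s : Step y) (c : SWalk (stepEnd s) y) →
                 Unique (verts c) → proj₁ s ∉ edgesOf c → ⊥
    ◃-no-cycle (g , inj₁ refl) c u g∉c =
      no-closed-walk (fwd g c) refl (s≤s z≤n) (¬Any⇒All¬ _ g∉c ∷ edgesOf-unique c u) u
    ◃-no-cycle (g , inj₂ (v , refl)) c u g∉c =
      no-closed-walk (bwd g v c) refl (s≤s z≤n) (¬Any⇒All¬ _ g∉c ∷ edgesOf-unique c u) u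

    no-return : ∀ {y x} (s : Step y) (p : PathsAfter x s) → y ∉ verts (SDPath.walk p)
    -- The part of p up to y, preceded by s, would be a semidirected cycle.
    no-return s p y∈p =
      ◃-no-cycle s (prefix w y∈p) (prefix-unique w y∈p (path-unique p))
                   (path-avoids p ∘ prefix-edgesOf⊆ w y∈p)
      where w = SDPath.walk p

    FirstSteps : Node → Node → EdgeId → Set
    FirstSteps y x f = (y ≡ x) ⊎ Σ (Step y) λ s → False (f ≟ proj₁ s) × PathsAfter x s

    module _ {y x : Node} {f : EdgeId} (f∼y : Incident f y) where

      tail-path : ∀ (s : Step y) (w : SWalk (stepEnd s) x) → Unique (y ∷ verts w) →
                  f ∉ proj₁ s ∷ edgesOf w → False (f ≟ proj₁ s) × PathsAfter x s
      tail-path s w u f∉ =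
        fromWitnessFalse (f∉ ∘ here) ,
        path w (AllPairs.tail u) (incident∉edgesOf w (step-incident s) (Unique[x∷xs]⇒x∉xs u))

      uncons : SDPath y x f → FirstSteps y x f
      uncons (mkPath [] _ _) = inj₁ refl
      uncons p@(mkPath (fwd g w) _ _) =
        inj₂ (s , tail-path s w (path-unique p) (path-avoids p))
        where s = g , inj₁ refl
      uncons p@(mkPath (bwd g u w) _ _) =
        inj₂ (s , tail-path s w (path-unique p) (path-avoids p))
        where s = g , inj₂ (u , refl)

      _◃-path_ : (s : Step y) → False (f ≟ proj₁ s) × PathsAfter x s → SDPath y x f
      s ◃-path (f≢s , q) =
        path (s ◃ w) (subst Unique (sym (verts-◃ s w)) (¬Any⇒All¬ _ y∉q ∷ path-unique q))
                     (f∉ ∘ subst (f ∈_) (edgesOf-◃ s w))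
        where
        w = SDPath.walk q
        y∉q = no-return s q
        f∉ : f ∉ proj₁ s ∷ edgesOf w
        f∉ (here f≡s)  = toWitnessFalse f≢s f≡s
        f∉ (there f∈q) = incident∉edgesOf w f∼y y∉q f∈q

      cons : FirstSteps y x f → SDPath y x f
      cons (inj₁ refl)     = path [] ([] ∷ []) λ ()
      cons (inj₂ (s , q)) = s ◃-path q

      cons∘uncons : ∀ p → cons (uncons p) ≡ p
      cons∘uncons (mkPath []          _ _) = SDPath-≡ refl
      cons∘uncons (mkPath (fwd _ _)   _ _) = SDPath-≡ refl
      cons∘uncons (mkPath (bwd _ _ _) _ _) = SDPath-≡ refl

      uncons∘cons : ∀ z → uncons (cons z) ≡ z
      uncons∘cons (inj₁ refl) = refl
      uncons∘cons (inj₂ ((g , inj₁ refl) , _)) =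
        cong (λ q → inj₂ ((g , inj₁ refl) , q)) (cong₂ _,_ (T-irrelevant _ _) (SDPath-≡ refl))
      uncons∘cons (inj₂ ((g , inj₂ (u , refl)) , _)) =
        cong (λ q → inj₂ ((g , inj₂ (u , refl)) , q)) (cong₂ _,_ (T-irrelevant _ _) (SDPath-≡ refl))

      SDPath↔FirstSteps : SDPath y x f ↔ FirstSteps y x f
      SDPath↔FirstSteps = mk↔ₛ′ uncons cons uncons∘cons cons∘uncons

    module RootComponent (r : Node) (no-dir-into : ∀ f → T (isDir f) → ¬ (r ∼ tgt f)) where

      away-from : ∀ {w} e → r ∼ w → Incident e w → src e ≡ w ⊎ (T (isUndir e) × tgt e ≡ w)
      away-from e _   (inj₁ e-from-w) = inj₁ e-from-w
      away-from e r∼w (inj₂ refl)     = inj₂ (¬T-not⇒T (λ dir → no-dir-into e dir r∼w) , refl)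

      step-along : ∀ {w} e → r ∼ w → Incident e w → Step w
      step-along e r∼w e∼w = e , away-from e r∼w e∼w

      step-along-unique : ∀ {w} e (r∼w : r ∼ w) (e∼w : Incident e w) (s : Step w) →
                          e ≡ proj₁ s → step-along e r∼w e∼w ≡ s
      step-along-unique e _ (inj₁ refl)   (_ , inj₁ refl)         refl = refl
      step-along-unique e _ (inj₁ e-from) (_ , inj₂ (_ , e-into)) refl =
        ⊥-elim (src≢tgt e (trans e-from (sym e-into)))
      step-along-unique e _ (inj₂ e-into) (_ , inj₁ e-from)       refl =
        ⊥-elim (src≢tgt e (trans e-from (sym e-into)))
      step-along-unique e _ (inj₂ refl)   (_ , inj₂ (_ , refl))   refl =
        cong (λ g-undir → e , inj₂ (g-undir , refl)) (T-irrelevant _ _)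

      EndpointPaths : Node → EdgeId → Set
      EndpointPaths x e = SDPath (tgt e) x e ⊎ SDPath (src e) x e

      Exits : Node → Node → Set
      Exits w x = (w ≡ x) ⊎ Σ (Step w) (PathsAfter x)

      EndpointPaths↔near⊎far : ∀ {w x} e (r∼w : r ∼ w) (e∼w : Incident e w) →
                               EndpointPaths x e ↔ (SDPath w x e ⊎ PathsAfter x (step-along e r∼w e∼w))
      EndpointPaths↔near⊎far e r∼w (inj₁ refl) = ⊎-comm _ _
      EndpointPaths↔near⊎far e r∼w (inj₂ refl) = ↔-refl

      EndpointPaths↔Exits : ∀ {w x} e → r ∼ w → Incident e w → EndpointPaths x e ↔ Exits w x
      EndpointPaths↔Exits {w} {x} e r∼w e∼w = begin
        EndpointPaths x e
          ↔⟨ EndpointPaths↔near⊎far e r∼w e∼w ⟩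
        (SDPath w x e ⊎ PathsAfter x sₑ)
          ↔⟨ SDPath↔FirstSteps e∼w ⊎-↔ ↔-refl ⟩
        (((w ≡ x) ⊎ Others) ⊎ PathsAfter x sₑ)
          ↔⟨ ⊎-assoc _ _ _ _ ⟩
        ((w ≡ x) ⊎ (Others ⊎ PathsAfter x sₑ))
          ↔⟨ ↔-refl ⊎-↔ ⊎-comm _ _ ⟩
        ((w ≡ x) ⊎ (PathsAfter x sₑ ⊎ Others))
          ↔⟨ ↔-refl ⊎-↔ ↔-sym (Σ-split _≟_ proj₁ (PathsAfter x) sₑ (step-along-unique e r∼w e∼w)) ⟩
        Exits w x ∎
        where
        open EquationalReasoning
        sₑ = step-along e r∼w e∼w
        Others = Σ (Step w) λ s → False (e ≟ proj₁ s) × PathsAfter x s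

      EndpointPaths-at : ∀ {w x} e e′ → r ∼ w → Incident e w → Incident e′ w →
                         EndpointPaths x e ↔ EndpointPaths x e′
      EndpointPaths-at e e′ r∼w e∼w e′∼w =
        ↔-trans (EndpointPaths↔Exits e r∼w e∼w) (↔-sym (EndpointPaths↔Exits e′ r∼w e′∼w))

      EndpointPaths-along : ∀ {a b x} e e′ → r ∼ a → a ∼ b → Incident e a → Incident e′ b →
                            EndpointPaths x e ↔ EndpointPaths x e′
      EndpointPaths-along e e′ r∼a ε e∼a e′∼a = EndpointPaths-at e e′ r∼a e∼a e′∼a
      EndpointPaths-along e e′ r∼a (g ◅ c∼b) e∼a e′∼b =
        ↔-trans (EndpointPaths-at e (proj₁ g) r∼a e∼a (UAdj-incidentˡ g))
                (EndpointPaths-along (proj₁ g) e′ (r∼a ◅◅ g ◅ ε) c∼b (UAdj-incidentʳ g) e′∼b)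

      incident-in-class : ∀ e → r ∼ src e ⊎ r ∼ tgt e → Σ Node λ a → r ∼ a × Incident e a
      incident-in-class e (inj₁ r∼src) = src e , r∼src , inj₁ refl
      incident-in-class e (inj₂ r∼tgt) = tgt e , r∼tgt , inj₂ refl

      EndpointPaths-adm : ∀ {x} e e′ → r ∼ src e ⊎ r ∼ tgt e → r ∼ src e′ ⊎ r ∼ tgt e′ →
                          EndpointPaths x e ↔ EndpointPaths x e′
      EndpointPaths-adm e e′ e-adm e′-adm
        with incident-in-class e e-adm | incident-in-class e′ e′-adm
      ... | a , r∼a , e∼a | b , r∼b , e′∼b =
        EndpointPaths-along e e′ r∼a (reverse UAdj-sym r∼a ◅◅ r∼b) e∼a e′∼b

module _ {n : ℕ} (N : Network n) where
  open NetDefs N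
  open Walks graph
  open Acyclic (Network.sdag N)

  MuSum : EdgeId → Fin (suc n) → Set
  MuSum e j = MuSet e (tgt e) j ⊎ MuSet e (src e) j

  MuSum-adm : ∀ r → RootClass r → ∀ e e′ → Adm r e → Adm r e′ → ∀ j → MuSum e j ↔ MuSum e′ j
  MuSum-adm r root e e′ e-adm e′-adm Fin.zero =
    Σ-⊎-cong λ _ → Σ-⊎-cong λ _ →
      RootComponent.EndpointPaths-adm r root e e′ e-adm e′-adm
  MuSum-adm r root e e′ e-adm e′-adm (Fin.suc _) =
    Σ-⊎-cong λ _ → Σ-⊎-cong λ _ → Σ-⊎-cong λ _ →
      RootComponent.EndpointPaths-adm r root e e′ e-adm e′-adm

lemma3 : ∀ {n : ℕ} (N : Network n) → NetDefs.Complete N →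
           (r : GraphDefs.Node (Network.graph N)) → NetDefs.RootClass N r →
           Σ (GraphDefs.EdgeId (Network.graph N)) (NetDefs.Adm N r) →
           ∀ (e e′ : GraphDefs.EdgeId (Network.graph N)) →
           NetDefs.Adm N r e → NetDefs.Adm N r e′ →
           ∀ (j : Fin (suc n)) (a b a′ b′ : ℕ) →
           HasCard (NetDefs.MuSet N e (GraphDefs.tgt (Network.graph N) e) j) a →
           HasCard (NetDefs.MuSet N e (GraphDefs.src (Network.graph N) e) j) b →
           HasCard (NetDefs.MuSet N e′ (GraphDefs.tgt (Network.graph N) e′) j) a′ →
           HasCard (NetDefs.MuSet N e′ (GraphDefs.src (Network.graph N) e′) j) b′ →
           a + b ≡ a′ + b′
lemma3 N _ r root _ e e′ e-adm e′-adm j a b a′ b′ a↔ b↔ a′↔ b′↔ = ↔⇒≡ (begin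
  Fin (a + b)         ↔⟨ +↔⊎ ⟩
  (Fin a ⊎ Fin b)     ↔⟨ a↔ ⊎-↔ b↔ ⟩
  MuSum N e j         ↔⟨ MuSum-adm N r root e e′ e-adm e′-adm j ⟩
  MuSum N e′ j        ↔⟨ a′↔ ⊎-↔ b′↔ ⟨
  (Fin a′ ⊎ Fin b′)   ↔⟨ +↔⊎ ⟨
  Fin (a′ + b′)       ∎)
  where open EquationalReasoning
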